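{- If a graph $G$ has a $[\lambda,C]$-coloring then it has a $[\lambda,C]$-partition.
   Context: A $[\lambda,C]$-coloring of $G=(V,E)$ is a map from $V$ to a set of $\lambda$ colors (adjacent vertices may share a color) such that every connected component of the subgraph induced by a single color class has at most $C$ vertices. A $[\lambda,C]$-partition of $G$ is a partition $\{P_1,\dots,P_t\}$ of $V$ such that each induced subgraph $G[P_i]$ is connected, each $|P_i|\le C$, and every clique of $G$ intersects at most $\lambda$ of the parts. -}

module Defs where

open import Data.Nat using (ℕ; suc)
open import Data.Fin using (Fin)
open import Data.Bool using (Bool; true)
open import Data.Product using (Σ; _×_; ∃)
open import Data.Empty using (⊥)
open import Relation.Nullary using (¬_)
open import Relation.Binary.PropositionalEquality using (_≡_; _≢_)
open import Function.Definitions using (Injective)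
open import Data.Fin.Subset using (Subset; _∈_)

record Graph (n : ℕ) : Set where
  field
    adj   : Fin n → Fin n → Bool
    sym   : ∀ u v → adj u v ≡ adj v u
    irrefl : ∀ v → adj v v ≡ true → ⊥
open Graph public

AtMost : {A : Set} → ℕ → (A → Set) → Set
AtMost {A} k P =
  ¬ (Σ (Fin (suc k) → A) λ f → Injective _≡_ _≡_ f × (∀ i → P (f i)))

data Reach {n : ℕ} (G : Graph n) (S : Fin n → Set) : Fin n → Fin n → Set where
  here : ∀ {u} → S u → Reach G S u u
  step : ∀ {u w v} → S u → adj G u w ≡ true → Reach G S w v → Reach G S u v

-- The component containing v is the set of u reachable from v within the
-- color class of v.
IsColoring : {n : ℕ} → Graph n → (lam C : ℕ) → (Fin n → Fin lam) → Set
IsColoring {n} G lam C c =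
  ∀ (v : Fin n) → AtMost C (λ u → Reach G (λ x → c x ≡ c v) v u)

IsClique : {n : ℕ} → Graph n → Subset n → Set
IsClique {n} G K = ∀ u v → u ∈ K → v ∈ K → u ≢ v → adj G u v ≡ true

-- A [λ,C]-partition into t parts P_i = {v | p v ≡ i}:
-- every part is nonempty (p surjective), induces a connected subgraph,
-- has at most C vertices, and every clique meets at most λ parts.
IsPartition : {n : ℕ} → Graph n → (lam C : ℕ) → (t : ℕ) → (Fin n → Fin t) → Set
IsPartition {n} G lam C t p =
  (∀ (i : Fin t) → ∃ λ v → p v ≡ i)
  × (∀ u v → p u ≡ p v → Reach G (λ x → p x ≡ p u) u v)
  × (∀ (i : Fin t) → AtMost C (λ v → p v ≡ i))
  × (∀ (K : Subset n) → IsClique G K →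
       AtMost lam (λ (i : Fin t) → ∃ λ v → v ∈ K × p v ≡ i))

HasColoring : {n : ℕ} → Graph n → (lam C : ℕ) → Set
HasColoring {n} G lam C = ∃ λ (c : Fin n → Fin lam) → IsColoring G lam C c

HasPartition : {n : ℕ} → Graph n → (lam C : ℕ) → Set
HasPartition {n} G lam C =
  Σ ℕ λ t → ∃ λ (p : Fin n → Fin t) → IsPartition G lam C t p

module Submission where

-- A [λ,C]-coloring yields a [λ,C]-partition whose parts are the
-- monochromatic components: u and v share a part iff a walk joins them
-- inside the colour class of u.
--   * Walks inside a vertex set S can be concatenated and reversed, so
--     "same monochromatic component" is an equivalence relation.  It is
--     decidable: reachability inside a decidable set is decided by
--     recursion on the size of the set, deleting the start vertex.
--   * A decidable equivalence relation on Fin n has a quotient map onto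
--     some Fin t, which numbers the parts.
--   * Each part is connected because a walk inside a colour class never
--     leaves the component it starts in, and each part is a component, so
--     it has at most C vertices.
--   * Two vertices of a clique with the same colour lie in one component,
--     so choosing a vertex in each part met by a clique and taking its
--     colour is injective.  By pigeonhole the clique meets at most λ parts.

open import Data.Nat using (ℕ; zero; suc; _<_; s≤s)
open import Data.Nat.Properties using (≤-refl; <-≤-trans)
open import Data.Fin using (Fin; zero; suc; _≟_)
open import Data.Fin.Properties using (any?; pigeonhole; <⇒≢; suc-injective)
open import Data.Fin.Subset using (_∈_)
open import Data.Bool using (true)
import Data.Bool as Bool
open import Data.Product using (_×_; ∃; _,_; proj₁; proj₂)
open import Data.Sum using (_⊎_; inj₁; inj₂)
open import Data.Empty using (⊥-elim)
open import Data.List using (List; length; filter; allFin)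
import Data.List.Relation.Unary.Any as Any
open import Data.List.Membership.Propositional renaming (_∈_ to _∈L_)
open import Data.List.Membership.Propositional.Properties
  using (∈-filter⁺; ∈-filter⁻; ∈-allFin)
import Data.List.Membership.DecPropositional as DecMembership
open import Data.List.Properties using (filter-notAll)
open import Function.Base using (_on_)
open import Relation.Nullary using (¬_; Dec; yes; no)
open import Relation.Nullary.Decidable using (¬?; _×-dec_; map′)
open import Relation.Unary using (Pred)
import Relation.Unary as Unary
open import Relation.Binary.Core using (Rel)
open import Relation.Binary.Definitions using (Decidable)
open import Relation.Binary.Structures using (IsEquivalence)
open import Relation.Binary.PropositionalEquality
  using (_≡_; _≢_; refl; sym; trans; cong)
open import Level using (0ℓ)
open import Defs hiding (sym)

-- Counting: a set admitting a map to Fin k that separates its elements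
-- has at most k elements (pigeonhole).  The map may use the membership
-- proof, e.g. to look at a chosen witness.
AtMost-separated : ∀ {A : Set} {P : A → Set} k (g : ∀ x → P x → Fin k) →
  (∀ {x y} (px : P x) (py : P y) → g x px ≡ g y py → x ≡ y) → AtMost k P
AtMost-separated k g separates (f , f-injective , f∈P)
  with pigeonhole ≤-refl (λ j → g (f j) (f∈P j))
... | a , b , a<b , same = <⇒≢ a<b (f-injective (separates (f∈P a) (f∈P b) same))

AtMost-⊆ : ∀ {A : Set} {P Q : A → Set} k → (∀ x → P x → Q x) → AtMost k Q → AtMost k P
AtMost-⊆ k P⊆Q Q-small (f , f-injective , f∈P) =
  Q-small (f , f-injective , λ j → P⊆Q (f j) (f∈P j))

record Quotient {n : ℕ} (R : Rel (Fin n) 0ℓ) : Set where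
  field
    classes  : ℕ
    classOf  : Fin n → Fin classes
    onto     : ∀ i → ∃ λ v → classOf v ≡ i
    sound    : ∀ {u v} → classOf u ≡ classOf v → R u v
    complete : ∀ {u v} → R u v → classOf u ≡ classOf v

IsEquivalence-on : ∀ {A B : Set} {R : Rel B 0ℓ} (f : A → B) →
  IsEquivalence R → IsEquivalence (R on f)
IsEquivalence-on f E = record
  { refl = IsEquivalence.refl E ; sym = IsEquivalence.sym E ; trans = IsEquivalence.trans E }

-- Extending a quotient of Fin n (R restricted to the successors) to Fin
-- (suc n): vertex zero either joins the class of some related i, or forms a
-- new class of its own.
module QuotientStep {n : ℕ} {R : Rel (Fin (suc n)) 0ℓ}
                    (E : IsEquivalence R) (Q : Quotient (R on suc)) where
  open IsEquivalence E renaming (refl to R-refl; sym to R-sym; trans to R-trans)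
  open Quotient Q

  joinClass : (i : Fin n) → R zero (suc i) → Quotient R
  joinClass i R0i = record
    { classes = classes ; classOf = cls ; onto = onto′
    ; sound = sound′ _ _ ; complete = complete′ _ _ }
    where
      cls : Fin (suc n) → Fin classes
      cls zero    = classOf i
      cls (suc j) = classOf j
      onto′ : ∀ k → ∃ λ v → cls v ≡ k
      onto′ k with v , e ← onto k = suc v , e
      sound′ : ∀ u v → cls u ≡ cls v → R u v
      sound′ zero    zero    _ = R-refl
      sound′ zero    (suc j) e = R-trans R0i (sound e)
      sound′ (suc j) zero    e = R-sym (R-trans R0i (sound (sym e)))
      sound′ (suc a) (suc b) e = sound e
      complete′ : ∀ u v → R u v → cls u ≡ cls v
      complete′ zero    zero    _ = refl
      complete′ zero    (suc j) r = complete (R-trans (R-sym R0i) r)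
      complete′ (suc j) zero    r = sym (complete (R-trans (R-sym R0i) (R-sym r)))
      complete′ (suc a) (suc b) r = complete r

  newClass : (∀ i → ¬ R zero (suc i)) → Quotient R
  newClass isolated = record
    { classes = suc classes ; classOf = cls ; onto = onto′
    ; sound = sound′ _ _ ; complete = complete′ _ _ }
    where
      cls : Fin (suc n) → Fin (suc classes)
      cls zero    = zero
      cls (suc j) = suc (classOf j)
      onto′ : ∀ k → ∃ λ v → cls v ≡ k
      onto′ zero = zero , refl
      onto′ (suc k) with v , e ← onto k = suc v , cong suc e
      sound′ : ∀ u v → cls u ≡ cls v → R u v
      sound′ zero    zero    _ = R-refl
      sound′ (suc a) (suc b) e = sound (suc-injective e)
      complete′ : ∀ u v → R u v → cls u ≡ cls v
      complete′ zero    zero    _ = refl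
      complete′ zero    (suc j) r = ⊥-elim (isolated j r)
      complete′ (suc j) zero    r = ⊥-elim (isolated j (R-sym r))
      complete′ (suc a) (suc b) r = cong suc (complete r)

quotient : ∀ {n} {R : Rel (Fin n) 0ℓ} → IsEquivalence R → Decidable R → Quotient R
quotient {zero} E R? = record
  { classes = 0 ; classOf = λ () ; onto = λ ()
  ; sound = λ { {()} } ; complete = λ { {()} } }
quotient {suc n} {R} E R? = extend (any? (λ i → R? zero (suc i)))
  where
    open QuotientStep E (quotient (IsEquivalence-on suc E) (λ i j → R? (suc i) (suc j)))
    extend : Dec (∃ λ i → R zero (suc i)) → Quotient R
    extend (yes (i , R0i)) = joinClass i R0i
    extend (no none)       = newClass λ i R0i → none (i , R0i)

module Walks {n : ℕ} (G : Graph n) where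

  Reach-mono : ∀ {S T : Pred (Fin n) 0ℓ} → S Unary.⊆ T →
    ∀ {u v} → Reach G S u v → Reach G T u v
  Reach-mono S⊆T (here s)       = here (S⊆T s)
  Reach-mono S⊆T (step s uw r) = step (S⊆T s) uw (Reach-mono S⊆T r)

  Reach-source : ∀ {S u v} → Reach G S u v → S u
  Reach-source (here s)     = s
  Reach-source (step s _ _) = s

  Reach-target : ∀ {S u v} → Reach G S u v → S v
  Reach-target (here s)     = s
  Reach-target (step _ _ r) = Reach-target r

  Reach-++ : ∀ {S u v w} → Reach G S u v → Reach G S v w → Reach G S u w
  Reach-++ (here _)      r′ = r′
  Reach-++ (step s uw r) r′ = step s uw (Reach-++ r r′)

  Reach-reverse : ∀ {S u v} → Reach G S u v → Reach G S v u
  Reach-reverse (here s) = here s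
  Reach-reverse {u = u} (step {w = w} s uw r) =
    Reach-++ (Reach-reverse r)
             (step (Reach-source r) (trans (Graph.sym G w u) uw) (here s))

  -- A walk from u stays inside the set of vertices reachable from u:
  -- every vertex from a onwards is reached via the walk's prefix u ⇝ a.
  Reach-inside : ∀ {S u a v} → Reach G S u a → Reach G S a v →
    Reach G (Reach G S u) a v
  Reach-inside u⇝a (here _)      = here u⇝a
  Reach-inside u⇝a (step s aw r) =
    step u⇝a aw (Reach-inside (Reach-++ u⇝a (step s aw (here (Reach-source r)))) r)

  -- Shortcutting at x: a walk to v ≠ x either avoids x altogether, or,
  -- after its last visit to x, continues from a neighbour of x while
  -- avoiding x.
  avoid : ∀ {S a v} x → Reach G S a v → v ≢ x →
    Reach G (λ y → S y × y ≢ x) a v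
    ⊎ ∃ λ w → adj G x w ≡ true × Reach G (λ y → S y × y ≢ x) w v
  avoid x (here s) v≢x = inj₁ (here (s , v≢x))
  avoid {a = a} x (step {w = w} s aw r) v≢x with avoid x r v≢x | a ≟ x
  ... | inj₁ r′ | yes refl = inj₂ (w , aw , r′)
  ... | inj₁ r′ | no a≢x   = inj₁ (step (s , a≢x) aw r′)
  ... | inj₂ exit | _      = inj₂ exit

  exitNeighbour : ∀ {S u v} → Reach G S u v → u ≢ v →
    ∃ λ w → adj G u w ≡ true × Reach G (λ y → S y × y ≢ u) w v
  exitNeighbour (here _) u≢u = ⊥-elim (u≢u refl)
  exitNeighbour {u = u} (step {w = w} _ uw r) u≢v
    with avoid u r (λ v≡u → u≢v (sym v≡u))
  ... | inj₁ r′   = w , uw , r′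
  ... | inj₂ exit = exit

  _without_ : List (Fin n) → Fin n → List (Fin n)
  L without x = filter (λ y → ¬? (y ≟ x)) L

  length-without : ∀ {x L} → x ∈L L → length (L without x) < length L
  length-without {x} {L} x∈L =
    filter-notAll (λ y → ¬? (y ≟ x)) L (Any.map (λ x≡y y≢x → y≢x (sym x≡y)) x∈L)

  -- Reachability inside the vertices of a list L, by recursion on a bound
  -- k > length L: u reaches v ≠ u inside L iff some neighbour of u
  -- reaches v inside L without u (exitNeighbour).
  reachIn? : ∀ k (L : List (Fin n)) → length L < k → ∀ u v → Dec (Reach G (_∈L L) u v)
  reachIn? (suc k) L (s≤s bound) u v with DecMembership._∈?_ _≟_ u L
  ... | no u∉L = no λ r → u∉L (Reach-source r)
  ... | yes u∈L with u ≟ v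
  ...   | yes refl = yes (here u∈L)
  ...   | no u≢v
    with any? (λ w → (adj G u w Bool.≟ true)
                     ×-dec reachIn? k (L without u) (<-≤-trans (length-without u∈L) bound) w v)
  ...     | yes (w , uw , r) = yes (step u∈L uw (Reach-mono (λ m → proj₁ (∈-filter⁻ _ m)) r))
  ...     | no none = no λ r → none (lift (exitNeighbour r u≢v))
    where
      lift : ∃ (λ w → adj G u w ≡ true × Reach G (λ y → y ∈L L × y ≢ u) w v) →
             ∃ λ w → adj G u w ≡ true × Reach G (_∈L L without u) w v
      lift (w , uw , r) = w , uw , Reach-mono (λ (m , y≢u) → ∈-filter⁺ _ m y≢u) r

  reach? : ∀ {S : Pred (Fin n) 0ℓ} → Unary.Decidable S → ∀ u v → Dec (Reach G S u v)
  reach? {S} S? u v =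
    map′ (Reach-mono (λ m → proj₂ (∈-filter⁻ S? {xs = allFin n} m)))
         (Reach-mono (λ s → ∈-filter⁺ S? (∈-allFin _) s))
         (reachIn? _ (filter S? (allFin n)) ≤-refl u v)

module MonochromaticComponents {n k : ℕ} (G : Graph n) (c : Fin n → Fin k) where
  open Walks G

  SameComponent : Rel (Fin n) 0ℓ
  SameComponent u v = Reach G (λ x → c x ≡ c u) u v

  sameColour : ∀ {u v} → SameComponent u v → c v ≡ c u
  sameColour = Reach-target

  -- Both endpoints have the same colour, so the class of u is the class of
  -- v; hence walks may be reversed and concatenated.
  isEquivalence : IsEquivalence SameComponent
  isEquivalence = record
    { refl  = here refl
    ; sym   = λ r → Reach-mono (λ e → trans e (sym (sameColour r))) (Reach-reverse r)
    ; trans = λ r r′ → Reach-++ r (Reach-mono (λ e → trans e (sameColour r)) r′) }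

  sameComponent? : Decidable SameComponent
  sameComponent? u v = reach? (λ x → c x ≟ c u) u v

  open Quotient (quotient isEquivalence sameComponent?) public

  -- Two vertices of a clique with the same colour are equal or adjacent,
  -- hence in one component.
  clique-sameComponent : ∀ {K} → IsClique G K → ∀ {u v} →
    u ∈ K → v ∈ K → c u ≡ c v → SameComponent u v
  clique-sameComponent K-clique {u} {v} u∈K v∈K cu≡cv with u ≟ v
  ... | yes refl = here refl
  ... | no u≢v   = step refl (K-clique u v u∈K v∈K u≢v) (here (sym cu≡cv))

  -- Each part is connected: a walk inside a colour class stays in its component.
  part-connected : ∀ u v → classOf u ≡ classOf v →
    Reach G (λ x → classOf x ≡ classOf u) u v
  part-connected u v same =
    Reach-mono (λ r → sym (complete r)) (Reach-inside (here refl) (sound same))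

  -- Each part is the component of any of its vertices.
  part-small : ∀ {C} → IsColoring G k C c → ∀ i → AtMost C (λ v → classOf v ≡ i)
  part-small {C} coloring i with w , w∈i ← onto i =
    AtMost-⊆ {Q = SameComponent w} C (λ v v∈i → sound (trans w∈i (sym v∈i))) (coloring w)

  -- Parts met by a clique are separated by the colour of a chosen vertex.
  clique-meets-few-parts : ∀ K → IsClique G K →
    AtMost k (λ i → ∃ λ v → v ∈ K × classOf v ≡ i)
  clique-meets-few-parts K K-clique =
    AtMost-separated {P = λ i → ∃ λ v → v ∈ K × classOf v ≡ i} k (λ i (v , _) → c v)
      λ (u , u∈K , u∈i) (v , v∈K , v∈j) cu≡cv →
        trans (sym u∈i)
              (trans (complete (clique-sameComponent K-clique u∈K v∈K cu≡cv)) v∈j)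

lemma1 : ∀ {n : ℕ} (G : Graph n) (lam C : ℕ) →
    HasColoring G lam C → HasPartition G lam C
lemma1 G lam C (c , coloring) =
  classes , classOf , onto , part-connected , part-small coloring , clique-meets-few-parts
  where open MonochromaticComponents G c
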